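{- Let $\Sigma$ be a finite alphabet. For every $\mathsf{K}_{\mathrm{t}}[\#]$ formula $\phi$ over $\Sigma$ there is a $\mathsf{C}\text{ - }\mathsf{RASP}$ program $P$ over $\Sigma$ such that for every nonempty string $w\in\Sigma^*$, $w$ end-satisfies $\phi$ if and only if $P$ accepts $w$; and conversely, for every $\mathsf{C}\text{ - }\mathsf{RASP}$ program $P$ over $\Sigma$ there is a $\mathsf{K}_{\mathrm{t}}[\#]$ formula $\phi$ over $\Sigma$ such that for every nonempty $w\in\Sigma^*$, $w$ end-satisfies $\phi$ if and only if $P$ accepts $w$. In particular, a language is recognized by a $\mathsf{C}\text{ - }\mathsf{RASP}$ program if and only if it is defined by a $\mathsf{K}_{\mathrm{t}}[\#]$ formula.
   Context: Strings are $w=w_1w_2\cdots w_n$ with $n\ge 1$ over a finite alphabet $\Sigma$. The logic $\mathsf{K}_{\mathrm{t}}[\#]$: formulas $F ::= Q_a \mid \lnot F \mid F\land F \mid C\le C \mid \top$ (for $a\in\Sigma$), and count terms $C ::= \#[F] \mid C+C \mid C-C \mid 1$. They are interpreted at a position $i\in[1,n]$ of $w$: $\#[F]^{w,i}=|\{j\in[1,i] : w,j\vDash F\}|$, $(C_1\pm C_2)^{w,i}=C_1^{w,i}\pm C_2^{w,i}$, $1^{w,i}=1$; $w,i\vDash Q_a$ iff $w_i=a$; $\lnot$ and $\land$ are as usual; $w,i\vDash C_1\le C_2$ iff $C_1^{w,i}\le C_2^{w,i}$; $w,i\vDash\top$ always. A string $w$ of length $n$ end-satisfies $\phi$ iff $w,n\vDash\phi$;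 the language defined by $\phi$ is the set of (nonempty) strings that end-satisfy $\phi$. A $\mathsf{C}\text{ - }\mathsf{RASP}$ program over $\Sigma$ is a finite sequence of operations, each defining either a Boolean-valued sequence $P(i)$ or an integer-valued sequence $C(i)$ over positions $i\in[1,n]$ of the input $w$, in terms of earlier operations. Boolean-valued operations: $P(i):=Q_a(i)$ for $a\in\Sigma$ (true iff $w_i=a$); $P(i):=\lnot P_1(i)$; $P(i):=P_1(i)\land P_2(i)$; $P(i):=C_1(i)\le C_2(i)$; $P(i):=1$ (always true). Count-valued operations: $C(i):=\#[j\le i]\,P(j)$ (the number of $j\in[1,i]$ with $P(j)$ true); $C(i):=P(i)\,?\,C_1(i):C_2(i)$ (equal to $C_1(i)$ if $P(i)$ is true and to $C_2(i)$ otherwise); $C(i):=C_1(i)+C_2(i)$; $C(i):=C_1(i)-C_2(i)$; $C(i):=\min(C_1(i),C_2(i))$; $C(i):=\max(C_1(i),C_2(i))$; $C(i):=1$. The last operation of the program must be Boolean-valued, and the program accepts an input $w$ of length $n$ iff its last operation is true at position $n$. -}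

module Defs where

open import Data.Nat using (ℕ; zero; suc)
import Data.Nat
open import Data.Integer using (ℤ; +_; _+_; _-_; _⊓_; _⊔_)
import Data.Integer
open import Data.Bool using (Bool; true; false; not; _∧_; if_then_else_; T?)
open import Data.Fin using (Fin; toℕ; fromℕ; _≟_)
open import Data.Vec using (Vec; lookup)
open import Data.List using (List; []; _∷_; length; allFin)
import Data.List
open import Relation.Nullary.Decidable using (⌊_⌋)
open import Relation.Binary.PropositionalEquality using (_≡_)
open import Data.Product using (Σ; _,_)

-- Alphabet Σ = Fin k (an arbitrary finite alphabet with k letters).
-- A nonempty string of length n = suc m is  w : Vec (Fin k) (suc m);
-- position i ∈ [1,n] is represented by  i : Fin n  (0-based, i.e. toℕ i + 1).

countUpTo : {n : ℕ} → (Fin n → Bool) → Fin n → ℕ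
countUpTo {n} P i =
  length (Data.List.filter (λ j → T? ((toℕ j Data.Nat.≤ᵇ toℕ i) ∧ P j)) (allFin n))

mutual
  data Form (k : ℕ) : Set where
    Q    : Fin k → Form k
    ¬ₖ   : Form k → Form k
    _∧ₖ_ : Form k → Form k → Form k
    _≤ₖ_ : Count k → Count k → Form k
    ⊤ₖ   : Form k

  data Count (k : ℕ) : Set where
    #[_] : Form k → Count k
    _+ₖ_ : Count k → Count k → Count k
    _-ₖ_ : Count k → Count k → Count k
    oneₖ : Count k

module _ {k n : ℕ} (w : Vec (Fin k) n) where
  mutual
    sat : Form k → Fin n → Bool
    sat (Q a) i = ⌊ lookup w i ≟ a ⌋
    sat (¬ₖ φ) i = not (sat φ i)
    sat (φ ∧ₖ ψ) i = sat φ i ∧ sat ψ i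
    sat (c ≤ₖ d) i = cval c i Data.Integer.≤ᵇ cval d i
    sat ⊤ₖ i = true

    cval : Count k → Fin n → ℤ
    cval #[ φ ] i = + countUpTo (λ j → sat φ j) i
    cval (c +ₖ d) i = cval c i + cval d i
    cval (c -ₖ d) i = cval c i - cval d i
    cval oneₖ i = + 1

EndSat : {k m : ℕ} → Form k → Vec (Fin k) (suc m) → Set
EndSat {m = m} φ w = sat w φ (fromℕ m) ≡ true

data Ty : Set where
  bool cnt : Ty

-- references to earlier operations (de Bruijn; most recent first)
data Var : List Ty → Ty → Set where
  here  : ∀ {Γ τ} → Var (τ ∷ Γ) τ
  there : ∀ {Γ τ σ} → Var Γ τ → Var (σ ∷ Γ) τ

data Op (k : ℕ) (Γ : List Ty) : Ty → Set where
  opQ     : Fin k → Op k Γ bool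
  opNot   : Var Γ bool → Op k Γ bool
  opAnd   : Var Γ bool → Var Γ bool → Op k Γ bool
  opLeq   : Var Γ cnt → Var Γ cnt → Op k Γ bool
  opTrue  : Op k Γ bool
  opCount : Var Γ bool → Op k Γ cnt
  opIte   : Var Γ bool → Var Γ cnt → Var Γ cnt → Op k Γ cnt
  opAdd   : Var Γ cnt → Var Γ cnt → Op k Γ cnt
  opSub   : Var Γ cnt → Var Γ cnt → Op k Γ cnt
  opMin   : Var Γ cnt → Var Γ cnt → Op k Γ cnt
  opMax   : Var Γ cnt → Var Γ cnt → Op k Γ cnt
  opOne   : Op k Γ cnt

data Ops (k : ℕ) : List Ty → Set where
  []  : Ops k []
  _▷_ : ∀ {Γ τ} → Ops k Γ → Op k Γ τ → Ops k (τ ∷ Γ)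

Program : ℕ → Set
Program k = Σ (List Ty) (λ Γ → Ops k (bool ∷ Γ))

Val : Ty → Set
Val bool = Bool
Val cnt  = ℤ

data Env (n : ℕ) : List Ty → Set where
  []  : Env n []
  _▷_ : ∀ {Γ τ} → Env n Γ → (Fin n → Val τ) → Env n (τ ∷ Γ)

lookupEnv : ∀ {n Γ τ} → Env n Γ → Var Γ τ → Fin n → Val τ
lookupEnv (ρ ▷ f) here = f
lookupEnv (ρ ▷ f) (there x) = lookupEnv ρ x

module _ {k n : ℕ} (w : Vec (Fin k) n) where
  evalOp : ∀ {Γ τ} → Env n Γ → Op k Γ τ → Fin n → Val τ
  evalOp ρ (opQ a) i = ⌊ lookup w i ≟ a ⌋
  evalOp ρ (opNot x) i = not (lookupEnv ρ x i)
  evalOp ρ (opAnd x y) i = lookupEnv ρ x i ∧ lookupEnv ρ y i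
  evalOp ρ (opLeq x y) i = lookupEnv ρ x i Data.Integer.≤ᵇ lookupEnv ρ y i
  evalOp ρ opTrue i = true
  evalOp ρ (opCount x) i = + countUpTo (lookupEnv ρ x) i
  evalOp ρ (opIte p x y) i = if lookupEnv ρ p i then lookupEnv ρ x i else lookupEnv ρ y i
  evalOp ρ (opAdd x y) i = lookupEnv ρ x i + lookupEnv ρ y i
  evalOp ρ (opSub x y) i = lookupEnv ρ x i - lookupEnv ρ y i
  evalOp ρ (opMin x y) i = lookupEnv ρ x i ⊓ lookupEnv ρ y i
  evalOp ρ (opMax x y) i = lookupEnv ρ x i ⊔ lookupEnv ρ y i
  evalOp ρ opOne i = + 1

  evalOps : ∀ {Γ} → Ops k Γ → Env n Γ
  evalOps [] = []
  evalOps (ops ▷ o) = let ρ = evalOps ops in ρ ▷ evalOp ρ o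

Accepts : {k m : ℕ} → Program k → Vec (Fin k) (suc m) → Set
Accepts {m = m} (Γ , ops) w = lookupEnv (evalOps w ops) here (fromℕ m) ≡ true

{-# OPTIONS --safe #-}

-- A formula compiles to a program by emitting one operation per subformula and
-- subterm after the code of its arguments: every connective and count term of
-- K_t[#] has a C-RASP operation with the same pointwise meaning.  Conversely,
-- the Boolean operations of a program are formula connectives, but count terms
-- have no conditional, min or max.  A count-valued operation therefore becomes a
-- decision tree whose inner nodes test formulas and whose leaves are count terms
-- (min c d is "if c ≤ d then c else d").  Arithmetic and comparison act leafwise,
-- and a tree of formulas folds into one formula by Boolean case distinction.
-- Both translations preserve the value at every position, so in particular at
-- the last one.

module Submission where

open import Defs
open import Data.Nat using (ℕ; suc)
open import Data.Fin using (Fin)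
open import Data.Vec using (Vec)
open import Data.Product using (_×_; ∃)
open import Function.Bundles using (_⇔_)

open import Data.Bool using (Bool; true; false; not; _∧_; if_then_else_; T; T?)
open import Data.Fin using (toℕ; fromℕ)
open import Data.Integer using (ℤ; +_; _+_; _-_; _≤_; _≤ᵇ_; _⊓_; _⊔_)
open import Data.Integer.Properties
  using (≤ᵇ⇒≤; ≤⇒≤ᵇ; ≰⇒>; <⇒≤; i≤j⇒i⊓j≡i; i≥j⇒i⊓j≡j; i≤j⇒i⊔j≡j; i≥j⇒i⊔j≡i)
open import Data.List using (List; []; _∷_; allFin; length)
open import Data.List.Properties using (filter-≐)
import Data.Nat as ℕ
open import Data.Product using (_,_)
open import Function.Base using (id; _∘_)
open import Function.Bundles using (mk⇔)
open import Relation.Binary.PropositionalEquality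
open import Relation.Nullary.Reflects using (Reflects; ofʸ; ofⁿ; fromEquivalence)

private
  variable
    n : ℕ
    Γ : List Ty
    σ₁ σ₂ τ : Ty
    A B C : Set

countUpTo-cong : {P R : Fin n → Bool} → (∀ j → P j ≡ R j) → ∀ i → countUpTo P i ≡ countUpTo R i
countUpTo-cong {n} {P} {R} P≗R i =
  cong length (filter-≐ (T? ∘ selected P) (T? ∘ selected R) (to , from) (allFin n))
  where
  selected : (Fin n → Bool) → Fin n → Bool
  selected S j = (toℕ j ℕ.≤ᵇ toℕ i) ∧ S j
  to : ∀ {j} → T (selected P j) → T (selected R j)
  to {j} = subst T (cong (_ ∧_) (P≗R j))
  from : ∀ {j} → T (selected R j) → T (selected P j)
  from {j} = subst T (cong (_ ∧_) (sym (P≗R j)))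

≤ᵇ-reflects : ∀ i j → Reflects (i ≤ j) (i ≤ᵇ j)
≤ᵇ-reflects i j = fromEquivalence ≤ᵇ⇒≤ ≤⇒≤ᵇ

if-≤ᵇ-⊓ : ∀ i j → (if i ≤ᵇ j then i else j) ≡ i ⊓ j
if-≤ᵇ-⊓ i j with i ≤ᵇ j | ≤ᵇ-reflects i j
... | true  | ofʸ i≤j = sym (i≤j⇒i⊓j≡i i≤j)
... | false | ofⁿ i≰j = sym (i≥j⇒i⊓j≡j (<⇒≤ (≰⇒> i≰j)))

if-≤ᵇ-⊔ : ∀ i j → (if i ≤ᵇ j then j else i) ≡ i ⊔ j
if-≤ᵇ-⊔ i j with i ≤ᵇ j | ≤ᵇ-reflects i j
... | true  | ofʸ i≤j = sym (i≤j⇒i⊔j≡j i≤j)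
... | false | ofⁿ i≰j = sym (i≥j⇒i⊔j≡i (<⇒≤ (≰⇒> i≰j)))

≡⇒≡true-⇔ : {a b : Bool} → a ≡ b → (a ≡ true) ⇔ (b ≡ true)
≡⇒≡true-⇔ refl = mk⇔ id id

output : {k : ℕ} → Program k → Vec (Fin k) n → Fin n → Bool
output (_ , ops) w = lookupEnv (evalOps w ops) here

module Compilation {k : ℕ} where

  infix 4 _⊑_

  data _⊑_ (ops : Ops k Γ) : ∀ {Δ} → Ops k Δ → Set where
    ⊑-refl : ops ⊑ ops
    ⊑-step : ∀ {Δ} {ops′ : Ops k Δ} {o : Op k Δ τ} → ops ⊑ ops′ → ops ⊑ ops′ ▷ o

  ⊑-trans : ∀ {Δ Θ} {a : Ops k Γ} {b : Ops k Δ} {c : Ops k Θ} → a ⊑ b → b ⊑ c → a ⊑ c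
  ⊑-trans a⊑b ⊑-refl = a⊑b
  ⊑-trans a⊑b (⊑-step b⊑c) = ⊑-step (⊑-trans a⊑b b⊑c)

  weaken : ∀ {Δ} {a : Ops k Γ} {b : Ops k Δ} → a ⊑ b → Var Γ τ → Var Δ τ
  weaken ⊑-refl x = x
  weaken (⊑-step a⊑b) x = there (weaken a⊑b x)

  lookupEnv-weaken : ∀ {Δ} (w : Vec (Fin k) n) {a : Ops k Γ} {b : Ops k Δ}
    (a⊑b : a ⊑ b) (x : Var Γ τ) →
    lookupEnv (evalOps w b) (weaken a⊑b x) ≡ lookupEnv (evalOps w a) x
  lookupEnv-weaken w ⊑-refl x = refl
  lookupEnv-weaken w (⊑-step a⊑b) x = lookupEnv-weaken w a⊑b x

  Semantics : Ty → Set
  Semantics τ = ∀ {n} → Vec (Fin k) n → Fin n → Val τ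

  record Compiled (ops : Ops k Γ) (τ : Ty) (⟦_⟧ : Semantics τ) : Set where
    field
      {Δ} : List Ty
      code : Ops k (τ ∷ Δ)
      extends : ops ⊑ code
      correct : ∀ {n} (w : Vec (Fin k) n) i → lookupEnv (evalOps w code) here i ≡ ⟦ w ⟧ i
  open Compiled

  append : {ops : Ops k Γ} (o : Op k Γ τ) → Compiled ops τ (λ w → evalOp w (evalOps w ops) o)
  append {ops = ops} o = record { code = ops ▷ o ; extends = ⊑-step ⊑-refl ; correct = λ _ _ → refl }

  append₂ : {ops : Ops k Γ} {f : Semantics σ₁} {g : Semantics σ₂}
    (op : ∀ {Δ} → Var Δ σ₁ → Var Δ σ₂ → Op k Δ τ) (F : Val σ₁ → Val σ₂ → Val τ) →
    (∀ {n Δ} (w : Vec (Fin k) n) (ρ : Env n Δ) x y i →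
       evalOp w ρ (op x y) i ≡ F (lookupEnv ρ x i) (lookupEnv ρ y i)) →
    (r : Compiled ops σ₁ f) → Compiled (code r) σ₂ g → Compiled ops τ (λ w i → F (f w i) (g w i))
  append₂ op F op-pointwise r s = record
    { code = code s ▷ op (weaken (extends s) here) here
    ; extends = ⊑-step (⊑-trans (extends r) (extends s))
    ; correct = λ w i → trans (op-pointwise w _ _ _ i)
        (cong₂ F (trans (cong-app (lookupEnv-weaken w (extends s) here) i) (correct r w i)) (correct s w i))
    }

  mutual
    compileForm : (ops : Ops k Γ) (φ : Form k) → Compiled ops bool (λ w → sat w φ)
    compileForm ops (Q a) = append (opQ a)
    compileForm ops (¬ₖ φ) = let r = compileForm ops φ in record
      { code = code r ▷ opNot here
      ; extends = ⊑-step (extends r)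
      ; correct = λ w i → cong not (correct r w i)
      }
    compileForm ops (φ ∧ₖ ψ) = let r = compileForm ops φ in
      append₂ opAnd _∧_ (λ _ _ _ _ _ → refl) r (compileForm (code r) ψ)
    compileForm ops (c ≤ₖ d) = let r = compileCount ops c in
      append₂ opLeq _≤ᵇ_ (λ _ _ _ _ _ → refl) r (compileCount (code r) d)
    compileForm ops ⊤ₖ = append opTrue

    compileCount : (ops : Ops k Γ) (c : Count k) → Compiled ops cnt (λ w → cval w c)
    compileCount ops #[ φ ] = let r = compileForm ops φ in record
      { code = code r ▷ opCount here
      ; extends = ⊑-step (extends r)
      ; correct = λ w i → cong +_ (countUpTo-cong (correct r w) i)
      }
    compileCount ops (c +ₖ d) = let r = compileCount ops c in
      append₂ opAdd _+_ (λ _ _ _ _ _ → refl) r (compileCount (code r) d)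
    compileCount ops (c -ₖ d) = let r = compileCount ops c in
      append₂ opSub _-_ (λ _ _ _ _ _ → refl) r (compileCount (code r) d)
    compileCount ops oneₖ = append opOne

  compile : Form k → Program k
  compile φ = _ , code (compileForm [] φ)

  output-compile : ∀ φ (w : Vec (Fin k) n) i → output (compile φ) w i ≡ sat w φ i
  output-compile φ = correct (compileForm [] φ)

module Decompilation {k : ℕ} where

  data Tree (A : Set) : Set where
    leaf : A → Tree A
    node : Form k → Tree A → Tree A → Tree A

  _>>=_ : Tree A → (A → Tree B) → Tree B
  leaf a >>= f = f a
  node φ s t >>= f = node φ (s >>= f) (t >>= f)

  zipWith : (A → B → Tree C) → Tree A → Tree B → Tree C
  zipWith f s t = s >>= λ a → t >>= f a

  ifₖ_then_else_ : Form k → Form k → Form k → Form k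
  ifₖ φ then ψ else χ = ¬ₖ (φ ∧ₖ ¬ₖ ψ) ∧ₖ ¬ₖ (¬ₖ φ ∧ₖ ¬ₖ χ)

  collapse : Tree (Form k) → Form k
  collapse (leaf φ) = φ
  collapse (node φ s t) = ifₖ φ then collapse s else collapse t

  _≤ᵗ_ : Tree (Count k) → Tree (Count k) → Form k
  s ≤ᵗ t = collapse (zipWith (λ c d → leaf (c ≤ₖ d)) s t)

  module _ (w : Vec (Fin k) n) where

    evalTree : {V : Set} → (A → Fin n → V) → Tree A → Fin n → V
    evalTree ⟦_⟧ (leaf a) i = ⟦ a ⟧ i
    evalTree ⟦_⟧ (node φ s t) i = if sat w φ i then evalTree ⟦_⟧ s i else evalTree ⟦_⟧ t i

    evalTree->>= : {U V : Set} (⟦_⟧ᴬ : A → Fin n → U) (⟦_⟧ᴮ : B → Fin n → V) (G : U → V)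
      (t : Tree A) (f : A → Tree B) (i : Fin n) → (∀ a → evalTree ⟦_⟧ᴮ (f a) i ≡ G (⟦ a ⟧ᴬ i)) →
      evalTree ⟦_⟧ᴮ (t >>= f) i ≡ G (evalTree ⟦_⟧ᴬ t i)
    evalTree->>= ⟦_⟧ᴬ ⟦_⟧ᴮ G (leaf a) f i f≈G = f≈G a
    evalTree->>= ⟦_⟧ᴬ ⟦_⟧ᴮ G (node φ s t) f i f≈G with sat w φ i
    ... | true  = evalTree->>= ⟦_⟧ᴬ ⟦_⟧ᴮ G s f i f≈G
    ... | false = evalTree->>= ⟦_⟧ᴬ ⟦_⟧ᴮ G t f i f≈G

    evalTree-zipWith : {U V W : Set}
      (⟦_⟧ᴬ : A → Fin n → U) (⟦_⟧ᴮ : B → Fin n → V) (⟦_⟧ᶜ : C → Fin n → W) (F : U → V → W)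
      (f : A → B → Tree C) (s : Tree A) (t : Tree B) (i : Fin n) →
      (∀ a b → evalTree ⟦_⟧ᶜ (f a b) i ≡ F (⟦ a ⟧ᴬ i) (⟦ b ⟧ᴮ i)) →
      evalTree ⟦_⟧ᶜ (zipWith f s t) i ≡ F (evalTree ⟦_⟧ᴬ s i) (evalTree ⟦_⟧ᴮ t i)
    evalTree-zipWith ⟦_⟧ᴬ ⟦_⟧ᴮ ⟦_⟧ᶜ F f s t i f≈F =
      evalTree->>= ⟦_⟧ᴬ ⟦_⟧ᶜ (λ u → F u (evalTree ⟦_⟧ᴮ t i)) s _ i
        (λ a → evalTree->>= ⟦_⟧ᴮ ⟦_⟧ᶜ (F (⟦ a ⟧ᴬ i)) t (f a) i (f≈F a))

    sat-ifₖ : ∀ φ ψ χ i → sat w (ifₖ φ then ψ else χ) i ≡ (if sat w φ i then sat w ψ i else sat w χ i)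
    sat-ifₖ φ ψ χ i with sat w φ i | sat w ψ i | sat w χ i
    ... | true  | true  | _     = refl
    ... | true  | false | _     = refl
    ... | false | _     | true  = refl
    ... | false | _     | false = refl

    sat-collapse : ∀ t i → sat w (collapse t) i ≡ evalTree (sat w) t i
    sat-collapse (leaf φ) i = refl
    sat-collapse (node φ s t) i rewrite sat-ifₖ φ (collapse s) (collapse t) i
      | sat-collapse s i | sat-collapse t i = refl

    sat-≤ᵗ : ∀ s t i → sat w (s ≤ᵗ t) i ≡ (evalTree (cval w) s i ≤ᵇ evalTree (cval w) t i)
    sat-≤ᵗ s t i = trans (sat-collapse (zipWith leq s t) i)
      (evalTree-zipWith (cval w) (cval w) (sat w) _≤ᵇ_ leq s t i λ _ _ → refl)
      where
      leq : Count k → Count k → Tree (Form k)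
      leq c d = leaf (c ≤ₖ d)

  Term : Ty → Set
  Term bool = Form k
  Term cnt = Tree (Count k)

  ⟦_⟧ : Term τ → Vec (Fin k) n → Fin n → Val τ
  ⟦_⟧ {bool} φ w = sat w φ
  ⟦_⟧ {cnt} t w = evalTree w (cval w) t

  data Terms : List Ty → Set where
    []  : Terms []
    _▷_ : Terms Γ → Term τ → Terms (τ ∷ Γ)

  lookupTerm : Terms Γ → Var Γ τ → Term τ
  lookupTerm (ts ▷ t) here = t
  lookupTerm (ts ▷ t) (there x) = lookupTerm ts x

  minₖ maxₖ : Count k → Count k → Tree (Count k)
  minₖ c d = node (c ≤ₖ d) (leaf c) (leaf d)
  maxₖ c d = node (c ≤ₖ d) (leaf d) (leaf c)

  decompileOp : Terms Γ → Op k Γ τ → Term τ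
  decompileOp ts (opQ a) = Q a
  decompileOp ts (opNot x) = ¬ₖ (lookupTerm ts x)
  decompileOp ts (opAnd x y) = lookupTerm ts x ∧ₖ lookupTerm ts y
  decompileOp ts (opLeq x y) = lookupTerm ts x ≤ᵗ lookupTerm ts y
  decompileOp ts opTrue = ⊤ₖ
  decompileOp ts (opCount x) = leaf #[ lookupTerm ts x ]
  decompileOp ts (opIte p x y) = node (lookupTerm ts p) (lookupTerm ts x) (lookupTerm ts y)
  decompileOp ts (opAdd x y) = zipWith (λ c d → leaf (c +ₖ d)) (lookupTerm ts x) (lookupTerm ts y)
  decompileOp ts (opSub x y) = zipWith (λ c d → leaf (c -ₖ d)) (lookupTerm ts x) (lookupTerm ts y)
  decompileOp ts (opMin x y) = zipWith minₖ (lookupTerm ts x) (lookupTerm ts y)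
  decompileOp ts (opMax x y) = zipWith maxₖ (lookupTerm ts x) (lookupTerm ts y)
  decompileOp ts opOne = leaf oneₖ

  decompileOps : Ops k Γ → Terms Γ
  decompileOps [] = []
  decompileOps (ops ▷ o) = let ts = decompileOps ops in ts ▷ decompileOp ts o

  module _ (w : Vec (Fin k) n) where

    _≈_ : Env n Γ → Terms Γ → Set
    ρ ≈ ts = ∀ {σ} (x : Var _ σ) i → lookupEnv ρ x i ≡ ⟦ lookupTerm ts x ⟧ w i

    module _ {ρ : Env n Γ} {ts : Terms Γ} (ρ≈ts : ρ ≈ ts) where

      zipWith-sound : (F : ℤ → ℤ → ℤ) (f : Count k → Count k → Tree (Count k))
        (x y : Var Γ cnt) (i : Fin n) →
        (∀ c d → evalTree w (cval w) (f c d) i ≡ F (cval w c i) (cval w d i)) →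
        F (lookupEnv ρ x i) (lookupEnv ρ y i) ≡ evalTree w (cval w) (zipWith f (lookupTerm ts x) (lookupTerm ts y)) i
      zipWith-sound F f x y i f≈F = begin
        F (lookupEnv ρ x i) (lookupEnv ρ y i)
          ≡⟨ cong₂ F (ρ≈ts x i) (ρ≈ts y i) ⟩
        F (evalTree w (cval w) s i) (evalTree w (cval w) t i)
          ≡⟨ evalTree-zipWith w (cval w) (cval w) (cval w) F f s t i f≈F ⟨
        evalTree w (cval w) (zipWith f s t) i ∎
        where
        open ≡-Reasoning
        s = lookupTerm ts x
        t = lookupTerm ts y

      decompileOp-sound : (o : Op k Γ τ) (i : Fin n) → evalOp w ρ o i ≡ ⟦ decompileOp ts o ⟧ w i
      decompileOp-sound (opQ a) i = refl
      decompileOp-sound (opNot x) i = cong not (ρ≈ts x i)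
      decompileOp-sound (opAnd x y) i = cong₂ _∧_ (ρ≈ts x i) (ρ≈ts y i)
      decompileOp-sound (opLeq x y) i =
        trans (cong₂ _≤ᵇ_ (ρ≈ts x i) (ρ≈ts y i)) (sym (sat-≤ᵗ w (lookupTerm ts x) (lookupTerm ts y) i))
      decompileOp-sound opTrue i = refl
      decompileOp-sound (opCount x) i = cong +_ (countUpTo-cong (ρ≈ts x) i)
      decompileOp-sound (opIte p x y) i rewrite ρ≈ts p i | ρ≈ts x i | ρ≈ts y i = refl
      decompileOp-sound (opAdd x y) i = zipWith-sound _+_ (λ c d → leaf (c +ₖ d)) x y i λ _ _ → refl
      decompileOp-sound (opSub x y) i = zipWith-sound _-_ (λ c d → leaf (c -ₖ d)) x y i λ _ _ → refl
      decompileOp-sound (opMin x y) i =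
        zipWith-sound _⊓_ minₖ x y i λ c d → if-≤ᵇ-⊓ (cval w c i) (cval w d i)
      decompileOp-sound (opMax x y) i =
        zipWith-sound _⊔_ maxₖ x y i λ c d → if-≤ᵇ-⊔ (cval w c i) (cval w d i)
      decompileOp-sound opOne i = refl

    decompileOps-sound : (ops : Ops k Γ) → evalOps w ops ≈ decompileOps ops
    decompileOps-sound (ops ▷ o) here i = decompileOp-sound (decompileOps-sound ops) o i
    decompileOps-sound (ops ▷ o) (there x) i = decompileOps-sound ops x i

  decompile : Program k → Form k
  decompile (_ , ops) = lookupTerm (decompileOps ops) here

  sat-decompile : ∀ P (w : Vec (Fin k) n) i → sat w (decompile P) i ≡ output P w i
  sat-decompile (_ , ops) w i = sym (decompileOps-sound w ops here i)

open Compilation using (compile; output-compile)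
open Decompilation using (decompile; sat-decompile)

theorem1 : (k : ℕ) →
    ((φ : Form k) → ∃ λ (P : Program k) →
        (m : ℕ) (w : Vec (Fin k) (suc m)) → (EndSat φ w ⇔ Accepts P w))
    ×
    ((P : Program k) → ∃ λ (φ : Form k) →
        (m : ℕ) (w : Vec (Fin k) (suc m)) → (EndSat φ w ⇔ Accepts P w))
theorem1 k =
    (λ φ → compile φ , λ m w → ≡⇒≡true-⇔ (sym (output-compile φ w (fromℕ m))))
  , λ where P@(_ , _) → decompile P , λ m w → ≡⇒≡true-⇔ (sat-decompile P w (fromℕ m))
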